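{- Let $n$ and $x$ be integers with $4 \le x \le n-3$ and $(n-4)x$ even. Let $d$ be the sequence of length $n$ $$d = (n-1,\, n-1,\, \underbrace{x, \ldots, x}_{n-4 \text{ times}},\, 2,\, 2).$$ Then $d$ is a $2$-factorable graphic sequence, and $d$ has no connected $2$-factor, i.e. there is no graph with degree sequence $d$ containing a connected $2$-regular spanning subgraph.
   Context: A finite nonincreasing sequence of positive integers $d=(d_1,\ldots,d_n)$ is graphic if there is a simple graph on vertices $v_1,\ldots,v_n$ with $\deg(v_i)=d_i$ for all $i$; such a graph is a realization of $d$. A graphic sequence $d$ is $k$-factorable if some realization of $d$ contains a $k$-factor, i.e. a $k$-regular spanning subgraph. A $k$-factor is connected if it is a connected graph. "$d$ has no connected $k$-factor" means no realization of $d$ contains a connected $k$-factor. -}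

module Defs where

open import Data.Nat using (ℕ; zero; suc; _+_; _∸_; _<_; _≤_)
open import Data.Nat.Properties using (_<?_)
open import Data.Bool using (Bool; true; false; if_then_else_)
open import Data.Fin using (Fin; toℕ)
open import Data.List using (List; map; allFin)
open import Data.Nat.ListAction using (sum)
open import Data.Product using (Σ; _×_; ∃)
open import Relation.Binary.PropositionalEquality using (_≡_)
open import Relation.Nullary using (¬_; does)

Graph : ℕ → Set
Graph n = Fin n → Fin n → Bool

IsSimple : ∀ {n} → Graph n → Set
IsSimple {n} G = (∀ (u v : Fin n) → G u v ≡ G v u) × (∀ (v : Fin n) → G v v ≡ false)

deg : ∀ {n} → Graph n → Fin n → ℕ
deg {n} G v = sum (map (λ u → if G v u then 1 else 0) (allFin n))

Realizes : ∀ {n} → Graph n → (Fin n → ℕ) → Set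
Realizes {n} G d = IsSimple G × (∀ (v : Fin n) → deg G v ≡ d v)

Graphic : ∀ {n} → (Fin n → ℕ) → Set
Graphic {n} d = Σ (Graph n) λ G → Realizes G d

-- H is a subgraph of G on the same vertex set (hence spanning).
SubgraphOf : ∀ {n} → Graph n → Graph n → Set
SubgraphOf {n} H G = ∀ (u v : Fin n) → H u v ≡ true → G u v ≡ true

Regular : ∀ {n} → ℕ → Graph n → Set
Regular {n} k H = ∀ (v : Fin n) → deg H v ≡ k

IsFactor : ∀ {n} → ℕ → Graph n → Graph n → Set
IsFactor k G H = IsSimple H × SubgraphOf H G × Regular k H

data Reach {n} (H : Graph n) : Fin n → Fin n → Set where
  here : ∀ {u} → Reach H u u
  step : ∀ {u v w} → H u v ≡ true → Reach H v w → Reach H u w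

Connected : ∀ {n} → Graph n → Set
Connected {n} H = ∀ (u v : Fin n) → Reach H u v

Factorable : ∀ {n} → ℕ → (Fin n → ℕ) → Set
Factorable {n} k d = Σ (Graph n) λ G → Realizes G d × Σ (Graph n) λ H → IsFactor k G H

HasConnectedFactor : ∀ {n} → ℕ → (Fin n → ℕ) → Set
HasConnectedFactor {n} k d =
  Σ (Graph n) λ G → Realizes G d × Σ (Graph n) λ H → IsFactor k G H × Connected H

seqD : (n x : ℕ) → Fin n → ℕ
seqD n x i with does (toℕ i <? 2) | does (toℕ i <? n ∸ 2)
... | true  | _     = n ∸ 1
... | false | true  = x
... | false | false = 2

module Submission where

-- Negative part: the two vertices of degree n − 1 are adjacent to everything,
-- so the two vertices of degree 2 see exactly these two hubs.  In a 2-factor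
-- each leaf must therefore use both hubs, which saturates the hubs: hubs and
-- leaves form a 4-cycle of the factor, cut off from the n − 4 middle vertices.
--
-- Positive part: put the middle vertices on a circulant graph Cay(ℤ_m, C) with
-- |C| = x − 2, namely C = {±1, …, ±h} when x is even and C = {±1, …, ±h, m/2}
-- when x is odd (then m = n − 4 is even); join both hubs to everything and the
-- two leaves to the hubs only.
-- The 2-factor is the 4-cycle hub–leaf–hub–leaf together with the Hamiltonian
-- cycle Cay(ℤ_m, {±1}) of the middle.

open import Defs
open import Data.Nat using (ℕ; _≤_; _∸_; _*_)
open import Data.Nat.Divisibility using (_∣_)
open import Data.Product using (_×_)
open import Relation.Nullary using (¬_)

open import Data.Bool using (Bool; true; false; _∧_; _∨_; not; if_then_else_)
open import Data.Bool.Properties using (∨-comm; ∨-zeroʳ; ∧-zeroʳ; ∧-conicalˡ; ∧-conicalʳ; ¬-not)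
open import Data.Fin using (Fin; toℕ) renaming (zero to fzero; suc to fsuc)
open import Data.Fin.Properties using () renaming (_≟_ to _≟ᶠ_)
open import Data.List using (tabulate)
open import Data.List.Properties using (map-tabulate)
open import Data.Nat using (zero; suc; _+_; _<_; z≤n; s≤s; z<s; s<s)
open import Data.Nat.Divisibility using (divides; ∣m+n∣m⇒∣n; ∣1⇒≡1; n∣m*n)
open import Data.Nat.ListAction using (sum)
open import Data.Nat.Primality using (euclidsLemma; prime[2])
open import Data.Nat.Properties
open import Data.Product using (Σ; ∃-syntax; _,_; proj₁)
open import Data.Sum using (_⊎_; inj₁; inj₂)
open import Function using (_∘_)
open import Function.Bundles using (mk⇔)
open import Relation.Binary.Definitions using (tri<; tri≈; tri>)
open import Relation.Binary.PropositionalEquality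
open import Relation.Nullary using (Dec; yes; no; does; contradiction)
open import Relation.Nullary.Decidable using (dec-true; dec-false; does-⇔)
open import Algebra.Properties.CommutativeSemigroup +-commutativeSemigroup using (interchange)

does≡true⇒ : ∀ {P : Set} (P? : Dec P) → does P? ≡ true → P
does≡true⇒ (yes p) _  = p
does≡true⇒ (no _)  ()

_⊆_ : {A : Set} → (A → Bool) → (A → Bool) → Set
f ⊆ g = ∀ a → f a ≡ true → g a ≡ true

∨-≡true : ∀ {a b} → a ∨ b ≡ true → a ≡ true ⊎ b ≡ true
∨-≡true {true}  _ = inj₁ refl
∨-≡true {false} e = inj₂ e

∧-monoʳ-true : ∀ {a b b'} → (b ≡ true → b' ≡ true) → a ∧ b ≡ true → a ∧ b' ≡ true
∧-monoʳ-true {true} b⇒b' = b⇒b'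

bit : Bool → ℕ
bit b = if b then 1 else 0

bit-mono : ∀ {a b} → (a ≡ true → b ≡ true) → bit a ≤ bit b
bit-mono {false} _    = z≤n
bit-mono {true}  a⇒b rewrite a⇒b refl = ≤-refl

bit-∨ : ∀ {a b} → (a ≡ true → b ≡ false) → bit (a ∨ b) ≡ bit a + bit b
bit-∨ {true}  {true}  a⇒¬b = contradiction (a⇒¬b refl) λ ()
bit-∨ {true}  {false} _    = refl
bit-∨ {false}         _    = refl

-- Counting over an initial segment of ℕ

count : ℕ → (ℕ → Bool) → ℕ
count zero    g = 0
count (suc n) g = bit (g 0) + count n (g ∘ suc)

count-cong : ∀ n {f g : ℕ → Bool} → (∀ k → k < n → f k ≡ g k) → count n f ≡ count n g
count-cong zero    _   = refl
count-cong (suc n) f≗g = cong₂ _+_ (cong bit (f≗g 0 z<s)) (count-cong n λ k k<n → f≗g (suc k) (s<s k<n))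

count-split : ∀ a b {n} (g : ℕ → Bool) → a + b ≡ n →
              count n g ≡ count a g + count b (λ k → g (a + k))
count-split zero    b g refl = refl
count-split (suc a) b g refl =
  trans (cong (bit (g 0) +_) (count-split a b (g ∘ suc) refl)) (sym (+-assoc (bit (g 0)) _ _))

count-true : ∀ n {g : ℕ → Bool} → (∀ k → k < n → g k ≡ true) → count n g ≡ n
count-true zero    _      = refl
count-true (suc n) g≡true rewrite g≡true 0 z<s =
  cong suc (count-true n λ k k<n → g≡true (suc k) (s<s k<n))

count-false : ∀ n {g : ℕ → Bool} → (∀ k → k < n → g k ≡ false) → count n g ≡ 0
count-false zero    _       = refl
count-false (suc n) g≡false rewrite g≡false 0 z<s =
  count-false n λ k k<n → g≡false (suc k) (s<s k<n)

count-∨ : ∀ n (f g : ℕ → Bool) → (∀ k → k < n → f k ≡ true → g k ≡ false) →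
          count n (λ k → f k ∨ g k) ≡ count n f + count n g
count-∨ zero    f g _        = refl
count-∨ (suc n) f g disjoint =
  trans (cong₂ _+_ (bit-∨ (disjoint 0 z<s))
                   (count-∨ n (f ∘ suc) (g ∘ suc) λ k k<n → disjoint (suc k) (s<s k<n)))
        (interchange (bit (f 0)) (bit (g 0)) _ _)

count-≟ : ∀ n {c} → c < n → count n (λ k → does (k ≟ c)) ≡ 1
count-≟ (suc n) {zero}  _         = cong suc (count-false n λ _ _ → refl)
count-≟ (suc n) {suc c} (s≤s c<n) = count-≟ n c<n

-- Counting over Fin n, and degrees

countFin : ∀ n → (Fin n → Bool) → ℕ
countFin n f = sum (tabulate (bit ∘ f))

deg≡countFin : ∀ {n} (G : Graph n) v → deg G v ≡ countFin n (G v)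
deg≡countFin G v = cong sum (map-tabulate (λ u → u) (bit ∘ G v))

countFin-toℕ : ∀ n (g : ℕ → Bool) → countFin n (g ∘ toℕ) ≡ count n g
countFin-toℕ zero    g = refl
countFin-toℕ (suc n) g = cong (bit (g 0) +_) (countFin-toℕ n (g ∘ suc))

deg-toℕ : ∀ {n} (A : ℕ → ℕ → Bool) (v : Fin n) →
          deg (λ u w → A (toℕ u) (toℕ w)) v ≡ count n (A (toℕ v))
deg-toℕ {n} A v = trans (deg≡countFin (λ u w → A (toℕ u) (toℕ w)) v) (countFin-toℕ n (A (toℕ v)))

countFin-≢ : ∀ {n} (v : Fin (suc n)) → countFin (suc n) (λ u → not (does (u ≟ᶠ v))) ≡ n
countFin-≢ {n}     fzero    = trans (countFin-toℕ n (λ _ → true)) (count-true n λ _ _ → refl)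
countFin-≢ {suc n} (fsuc v) = cong suc (countFin-≢ v)

countFin-mono : ∀ {n} {f g : Fin n → Bool} → f ⊆ g → countFin n f ≤ countFin n g
countFin-mono {zero}  _   = z≤n
countFin-mono {suc n} f⊆g = +-mono-≤ (bit-mono (f⊆g fzero)) (countFin-mono (f⊆g ∘ fsuc))

⊆-countFin⇒⊇ : ∀ {n} {f g : Fin n → Bool} → f ⊆ g → countFin n g ≤ countFin n f → g ⊆ f
⊆-countFin⇒⊇ {suc n} {f} {g} f⊆g g≤f fzero g₀ =
  ¬-not λ f₀ → <-irrefl refl (≤-trans (head≤ f₀) (countFin-mono (f⊆g ∘ fsuc)))
  where
    head≤ : f fzero ≡ false → suc (countFin n (g ∘ fsuc)) ≤ countFin n (f ∘ fsuc)
    head≤ f₀ = subst₂ (λ a b → bit a + countFin n (g ∘ fsuc) ≤ bit b + countFin n (f ∘ fsuc)) g₀ f₀ g≤f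
⊆-countFin⇒⊇ {suc n} {f} {g} f⊆g g≤f (fsuc u) =
  ⊆-countFin⇒⊇ (f⊆g ∘ fsuc) tail≤ u
  where
    tail≤ : countFin n (g ∘ fsuc) ≤ countFin n (f ∘ fsuc)
    tail≤ = +-cancelˡ-≤ (bit (g fzero)) _ _
              (≤-trans g≤f (+-monoˡ-≤ (countFin n (f ∘ fsuc)) (bit-mono (f⊆g fzero))))

full-degree⇒adjacent : ∀ {n} {G : Graph (suc n)} → IsSimple G →
                       ∀ {v} → deg G v ≡ n → ∀ {u} → u ≢ v → G v u ≡ true
full-degree⇒adjacent {n} {G} (_ , loopless) {v} deg≡n {u} u≢v =
  ⊆-countFin⇒⊇ G⊆others others≤ u (cong not (dec-false (u ≟ᶠ v) u≢v))
  where
    others : Fin (suc n) → Bool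
    others w = not (does (w ≟ᶠ v))
    G⊆others : G v ⊆ others
    G⊆others w Gvw = cong not (dec-false (w ≟ᶠ v) λ { refl → contradiction (trans (sym Gvw) (loopless v)) λ () })
    others≤ : countFin (suc n) others ≤ countFin (suc n) (G v)
    others≤ = ≤-reflexive (trans (countFin-≢ v) (trans (sym deg≡n) (deg≡countFin G v)))

Reach-preserves : ∀ {n} {H : Graph n} (P : Fin n → Set) →
                  (∀ {u v} → H u v ≡ true → P u → P v) → ∀ {u w} → Reach H u w → P u → P w
Reach-preserves P preserves here         Pu = Pu
Reach-preserves P preserves (step Huv r) Pu = Reach-preserves P preserves r (preserves Huv Pu)

seqD-hub : ∀ n x (v : Fin n) → toℕ v < 2 → seqD n x v ≡ n ∸ 1
seqD-hub n x v v<2 rewrite dec-true (toℕ v <? 2) v<2 = refl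

seqD-middle : ∀ n x (v : Fin n) → 2 ≤ toℕ v → toℕ v < n ∸ 2 → seqD n x v ≡ x
seqD-middle n x v 2≤v v<n∸2
  rewrite dec-false (toℕ v <? 2) (≤⇒≯ 2≤v) | dec-true (toℕ v <? n ∸ 2) v<n∸2 = refl

seqD-leaf : ∀ n x (v : Fin n) → 2 ≤ toℕ v → n ∸ 2 ≤ toℕ v → seqD n x v ≡ 2
seqD-leaf n x v 2≤v n∸2≤v
  rewrite dec-false (toℕ v <? 2) (≤⇒≯ 2≤v) | dec-false (toℕ v <? n ∸ 2) (≤⇒≯ n∸2≤v) = refl

module NoConnectedFactor (m x : ℕ) where

  N : ℕ
  N = 4 + m

  isHub : Fin N → Bool
  isHub u = does (toℕ u <? 2)

  isLeaf : Fin N → Bool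
  isLeaf u = does (2 + m ≤? toℕ u)

  countFin-isHub : countFin N isHub ≡ 2
  countFin-isHub = trans (countFin-toℕ N (λ k → does (k <? 2))) (cong (2 +_) (count-false (2 + m) λ _ _ → refl))

  countFin-isLeaf : countFin N isLeaf ≡ 2
  countFin-isLeaf =
    trans (countFin-toℕ N (λ k → does (2 + m ≤? k)))
      (trans (count-split (2 + m) 2 (λ k → does (2 + m ≤? k)) (+-comm (2 + m) 2))
        (cong₂ _+_ (count-false (2 + m) λ k k<2+m → dec-false (2 + m ≤? k) (<⇒≱ k<2+m))
                   (count-true 2 λ k _ → dec-true (2 + m ≤? 2 + m + k) (m≤m+n (2 + m) k))))

  module _ {G H : Graph N} (G-simple : IsSimple G) (deg-G : ∀ v → deg G v ≡ seqD N x v)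
           (H-sym : ∀ u v → H u v ≡ H v u) (H⊆G : SubgraphOf H G) (H-regular : Regular 2 H) where

    hub-adjacent : ∀ {v} → toℕ v < 2 → ∀ {u} → u ≢ v → G v u ≡ true
    hub-adjacent {v} v<2 = full-degree⇒adjacent G-simple (trans (deg-G v) (seqD-hub N x v v<2))

    leaf-G-neighbours : ∀ {v} → 2 + m ≤ toℕ v → G v ⊆ isHub
    leaf-G-neighbours {v} leaf = ⊆-countFin⇒⊇ hubs⊆ (≤-reflexive (trans (sym (deg≡countFin G v)) deg≡2))
      where
        deg≡2 : deg G v ≡ countFin N isHub
        deg≡2 = trans (deg-G v) (trans (seqD-leaf N x v (≤-trans (m≤m+n 2 m) leaf) leaf) (sym countFin-isHub))
        hubs⊆ : isHub ⊆ G v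
        hubs⊆ u hub = trans (proj₁ G-simple v u) (hub-adjacent (does≡true⇒ (toℕ u <? 2) hub) λ { refl →
          ≤⇒≯ leaf (≤-trans (does≡true⇒ (toℕ u <? 2) hub) (m≤m+n 2 m)) })

    leaf-H-neighbours : ∀ {v} → 2 + m ≤ toℕ v → isHub ⊆ H v
    leaf-H-neighbours {v} leaf =
      ⊆-countFin⇒⊇ (λ u Hvu → leaf-G-neighbours leaf u (H⊆G v u Hvu))
        (≤-reflexive (trans countFin-isHub (trans (sym (H-regular v)) (deg≡countFin H v))))

    hub-H-neighbours : ∀ {v} → toℕ v < 2 → H v ⊆ isLeaf
    hub-H-neighbours {v} v<2 =
      ⊆-countFin⇒⊇ (λ u leaf → trans (H-sym v u)
                     (leaf-H-neighbours (does≡true⇒ (2 + m ≤? toℕ u) leaf) v (dec-true (toℕ v <? 2) v<2)))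
        (≤-reflexive (trans (sym (deg≡countFin H v)) (trans (H-regular v) (sym countFin-isLeaf))))

    Outer : Fin N → Set
    Outer u = toℕ u < 2 ⊎ 2 + m ≤ toℕ u

    outer-closed : ∀ {u v} → H u v ≡ true → Outer u → Outer v
    outer-closed {u} {v} Huv (inj₁ u<2)  = inj₂ (does≡true⇒ (2 + m ≤? toℕ v) (hub-H-neighbours u<2 v Huv))
    outer-closed {u} {v} Huv (inj₂ leaf) = inj₁ (does≡true⇒ (toℕ v <? 2) (leaf-G-neighbours leaf v (H⊆G u v Huv)))

    H-disconnected : 0 < m → ¬ Connected H
    H-disconnected 0<m connected
      with Reach-preserves Outer outer-closed (connected fzero (fsuc (fsuc fzero))) (inj₁ z<s)
    ... | inj₁ (s≤s (s≤s ()))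
    ... | inj₂ 2+m≤2 = ≤⇒≯ 2+m≤2 (+-monoʳ-< 2 0<m)

  noConnectedFactor : 0 < m → ¬ HasConnectedFactor 2 (seqD N x)
  noConnectedFactor 0<m (G , (G-simple , deg-G) , H , ((H-sym , _) , H⊆G , H-regular) , connected) =
    H-disconnected G-simple deg-G H-sym H⊆G H-regular 0<m connected

evenOrOdd : ∀ n → ∃[ h ] (n ≡ h + h ⊎ n ≡ suc (h + h))
evenOrOdd zero    = 0 , inj₁ refl
evenOrOdd (suc n) with evenOrOdd n
... | h , inj₁ refl = h , inj₂ refl
... | h , inj₂ refl = suc h , inj₁ (cong suc (sym (+-suc h h)))

half-positive : ∀ {h} → 2 ≤ suc (h + h) → 1 ≤ h
half-positive {zero}  (s≤s ())
half-positive {suc h} _ = s≤s z≤n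

odd-indivisible : ∀ h → ¬ 2 ∣ suc (h + h)
odd-indivisible h 2∣odd =
  contradiction (∣1⇒≡1 (∣m+n∣m⇒∣n (subst (2 ∣_) (+-comm 1 (h + h)) 2∣odd) 2∣h+h)) λ ()
  where
    2∣h+h : 2 ∣ h + h
    2∣h+h = divides h (trans (cong (h +_) (sym (+-identityʳ h))) (*-comm 2 h))

module Circulant (m : ℕ) where

  -- offset i j is j − i mod m, for i, j < m
  offset : ℕ → ℕ → ℕ
  offset i j = if does (i ≤? j) then j ∸ i else j + m ∸ i

  offset-≤ : ∀ {i j} → i ≤ j → offset i j ≡ j ∸ i
  offset-≤ {i} {j} i≤j rewrite dec-true (i ≤? j) i≤j = refl

  offset-> : ∀ {i j} → j < i → offset i j ≡ j + m ∸ i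
  offset-> {i} {j} j<i rewrite dec-false (i ≤? j) (<⇒≱ j<i) = refl

  offset-flip : ∀ {i j} → i < j → offset j i ≡ m ∸ (j ∸ i)
  offset-flip {i} {j} i<j = begin
    offset j i              ≡⟨ offset-> i<j ⟩
    i + m ∸ j               ≡⟨ cong (i + m ∸_) (sym (m+[n∸m]≡n (<⇒≤ i<j))) ⟩
    i + m ∸ (i + (j ∸ i))   ≡⟨ [m+n]∸[m+o]≡n∸o i m (j ∸ i) ⟩
    m ∸ (j ∸ i)             ∎
    where open ≡-Reasoning

  count-rotate : ∀ {i} (g : ℕ → Bool) → i < m → count m (g ∘ offset i) ≡ count m g
  count-rotate {i} g i<m = begin
    count m (g ∘ offset i)
      ≡⟨ count-split i (m ∸ i) (g ∘ offset i) (m+[n∸m]≡n i≤m) ⟩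
    count i (g ∘ offset i) + count (m ∸ i) (λ j → g (offset i (i + j)))
      ≡⟨ cong₂ _+_ (count-cong i λ j j<i → cong g (wrapped j<i))
                   (count-cong (m ∸ i) λ j _ → cong g (shifted j)) ⟩
    count i (λ j → g (m ∸ i + j)) + count (m ∸ i) g
      ≡⟨ +-comm _ (count (m ∸ i) g) ⟩
    count (m ∸ i) g + count i (λ j → g (m ∸ i + j))
      ≡⟨ count-split (m ∸ i) i g (m∸n+n≡m i≤m) ⟨
    count m g ∎
    where
      open ≡-Reasoning
      i≤m : i ≤ m
      i≤m = <⇒≤ i<m
      wrapped : ∀ {j} → j < i → offset i j ≡ m ∸ i + j
      wrapped {j} j<i = trans (offset-> j<i) (trans (+-∸-assoc j i≤m) (+-comm j (m ∸ i)))
      shifted : ∀ j → offset i (i + j) ≡ j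
      shifted j = trans (offset-≤ (m≤m+n i j)) (m+n∸m≡n i j)

  record IsConnectionSet (C : ℕ → Bool) : Set where
    field
      zero∉     : C 0 ≡ false
      symmetric : ∀ {t} → 0 < t → t < m → C (m ∸ t) ≡ C t

  circulant : (ℕ → Bool) → ℕ → ℕ → Bool
  circulant C i j = does (i <? m) ∧ (does (j <? m) ∧ C (offset i j))

  module _ (C : ℕ → Bool) where

    circulant-inside : ∀ {i j} → i < m → j < m → circulant C i j ≡ C (offset i j)
    circulant-inside {i} {j} i<m j<m rewrite dec-true (i <? m) i<m | dec-true (j <? m) j<m = refl

    circulant-outsideˡ : ∀ {i} j → m ≤ i → circulant C i j ≡ false
    circulant-outsideˡ {i} j m≤i rewrite dec-false (i <? m) (≤⇒≯ m≤i) = refl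

    circulant-outsideʳ : ∀ i {j} → m ≤ j → circulant C i j ≡ false
    circulant-outsideʳ i {j} m≤j rewrite dec-false (j <? m) (≤⇒≯ m≤j) = ∧-zeroʳ _

    circulant-true⇒ : ∀ i j → circulant C i j ≡ true → i < m × j < m
    circulant-true⇒ i j e =
        does≡true⇒ (i <? m) (∧-conicalˡ (does (i <? m)) _ e)
      , does≡true⇒ (j <? m) (∧-conicalˡ (does (j <? m)) _ (∧-conicalʳ (does (i <? m)) _ e))

    count-circulant : ∀ {i} → i < m → count m (circulant C i) ≡ count m C
    count-circulant i<m = trans (count-cong m λ j j<m → circulant-inside i<m j<m) (count-rotate C i<m)

    circulant-irreflexive : IsConnectionSet C → ∀ i → circulant C i i ≡ false
    circulant-irreflexive isC i with i <? m
    ... | yes i<m = trans (circulant-inside i<m i<m)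
                      (trans (cong C (trans (offset-≤ (≤-refl {i})) (n∸n≡0 i))) (IsConnectionSet.zero∉ isC))
    ... | no  i≮m = circulant-outsideˡ i (≮⇒≥ i≮m)

    circulant-sym : IsConnectionSet C → ∀ i j → circulant C i j ≡ circulant C j i
    circulant-sym isC i j with i <? m | j <? m
    ... | yes i<m | yes j<m =
      trans (circulant-inside i<m j<m) (trans (offset-sym i<m j<m) (sym (circulant-inside j<m i<m)))
      where
        flipped : ∀ {i j} → i < j → j < m → C (offset j i) ≡ C (offset i j)
        flipped {i} i<j j<m rewrite offset-flip i<j | offset-≤ (<⇒≤ i<j) =
          IsConnectionSet.symmetric isC (m<n⇒0<n∸m i<j) (≤-<-trans (m∸n≤m _ i) j<m)
        offset-sym : ∀ {i j} → i < m → j < m → C (offset i j) ≡ C (offset j i)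
        offset-sym {i} {j} i<m j<m with <-cmp i j
        ... | tri< i<j _ _  = sym (flipped i<j j<m)
        ... | tri≈ _ refl _ = refl
        ... | tri> _ _ j<i  = flipped j<i i<m
    ... | yes _  | no j≮m = trans (circulant-outsideʳ i (≮⇒≥ j≮m)) (sym (circulant-outsideˡ i (≮⇒≥ j≮m)))
    ... | no i≮m | _      = trans (circulant-outsideˡ j (≮⇒≥ i≮m)) (sym (circulant-outsideʳ j (≮⇒≥ i≮m)))

  circulant-mono : ∀ {C D} → C ⊆ D → ∀ i → circulant C i ⊆ circulant D i
  circulant-mono {C} {D} C⊆D i j e with circulant-true⇒ C i j e
  ... | i<m , j<m =
    trans (circulant-inside D i<m j<m) (C⊆D _ (trans (sym (circulant-inside C i<m j<m)) e))

  ∪-isConnectionSet : ∀ {C D} → IsConnectionSet C → IsConnectionSet D →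
                      IsConnectionSet (λ t → C t ∨ D t)
  ∪-isConnectionSet isC isD = record
    { zero∉     = cong₂ _∨_ (IsConnectionSet.zero∉ isC) (IsConnectionSet.zero∉ isD)
    ; symmetric = λ 0<t t<m → cong₂ _∨_ (IsConnectionSet.symmetric isC 0<t t<m)
                                        (IsConnectionSet.symmetric isD 0<t t<m)
    }

  low : ℕ → ℕ → Bool
  low h t = does (1 ≤? t) ∧ does (t ≤? h)

  high : ℕ → ℕ → Bool
  high h t = does (1 ≤? t) ∧ does (m ∸ t ≤? h)

  -- band h = {±1, …, ±h}
  band : ℕ → ℕ → Bool
  band h t = low h t ∨ high h t

  band-isConnectionSet : ∀ {h} → IsConnectionSet (band h)
  band-isConnectionSet {h} = record { zero∉ = refl ; symmetric = symmetric }
    where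
      symmetric : ∀ {t} → 0 < t → t < m → band h (m ∸ t) ≡ band h t
      symmetric {t} 0<t t<m
        rewrite dec-true (1 ≤? m ∸ t) (m<n⇒0<n∸m t<m) | dec-true (1 ≤? t) 0<t | m∸[m∸n]≡n (<⇒≤ t<m) =
        ∨-comm (does (m ∸ t ≤? h)) (does (t ≤? h))

  band-mono : ∀ {h h'} → h ≤ h' → band h ⊆ band h'
  band-mono {h} {h'} h≤h' t e with ∨-≡true e
  ... | inj₁ low-t  = cong (_∨ high h' t) (∧-monoʳ-true widen low-t)
    where
      widen : does (t ≤? h) ≡ true → does (t ≤? h') ≡ true
      widen t≤h = dec-true (t ≤? h') (≤-trans (does≡true⇒ (t ≤? h) t≤h) h≤h')
  ... | inj₂ high-t = trans (cong (low h' t ∨_) (∧-monoʳ-true widen high-t)) (∨-zeroʳ _)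
    where
      widen : does (m ∸ t ≤? h) ≡ true → does (m ∸ t ≤? h') ≡ true
      widen m∸t≤h = dec-true (m ∸ t ≤? h') (≤-trans (does≡true⇒ (m ∸ t ≤? h) m∸t≤h) h≤h')

  band-∌ : ∀ {h t} → h < t → h < m ∸ t → band h t ≡ false
  band-∌ {h} {t} h<t h<m∸t
    rewrite dec-false (t ≤? h) (<⇒≱ h<t) | dec-false (m ∸ t ≤? h) (<⇒≱ h<m∸t) | ∧-zeroʳ (does (1 ≤? t)) = refl

  count-low : ∀ {h} → h < m → count m (low h) ≡ h
  count-low {h} h<m =
    trans (count-split (suc h) (m ∸ suc h) (low h) (m+[n∸m]≡n h<m))
      (trans (cong₂ _+_ (count-true h λ k k<h → dec-true (suc k ≤? h) k<h)
                        (count-false (m ∸ suc h) λ k _ → beyond k))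
             (+-identityʳ h))
    where
      beyond : ∀ k → low h (suc h + k) ≡ false
      beyond k rewrite dec-false (suc h + k ≤? h) (<⇒≱ (s≤s (m≤m+n h k))) = refl

  count-high : ∀ {h} → h < m → count m (high h) ≡ h
  count-high {h} h<m =
    trans (count-split (m ∸ h) h (high h) (m∸n+n≡m (<⇒≤ h<m)))
      (cong₂ _+_ (count-false (m ∸ h) λ k k<m∸h → before k<m∸h)
                 (count-true h λ k _ → within k))
    where
      before : ∀ {k} → k < m ∸ h → high h k ≡ false
      before {k} k<m∸h rewrite dec-false (m ∸ k ≤? h) (<⇒≱ (subst (_< m ∸ k) (m∸[m∸n]≡n (<⇒≤ h<m))
                                                               (∸-monoʳ-< k<m∸h (m∸n≤m m h)))) = ∧-zeroʳ _
      within : ∀ k → high h (m ∸ h + k) ≡ true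
      within k rewrite dec-true (1 ≤? m ∸ h + k) (≤-trans (m<n⇒0<n∸m h<m) (m≤m+n (m ∸ h) k))
                     | dec-true (m ∸ (m ∸ h + k) ≤? h)
                         (≤-trans (∸-monoʳ-≤ m (m≤m+n (m ∸ h) k)) (≤-reflexive (m∸[m∸n]≡n (<⇒≤ h<m)))) = refl

  count-band : ∀ {h} → h + h < m → count m (band h) ≡ h + h
  count-band {h} 2h<m =
    trans (count-∨ m (low h) (high h) disjoint) (cong₂ _+_ (count-low h<m) (count-high h<m))
    where
      h<m : h < m
      h<m = ≤-<-trans (m≤m+n h h) 2h<m
      disjoint : ∀ t → t < m → low h t ≡ true → high h t ≡ false
      disjoint t _ low-t rewrite dec-false (m ∸ t ≤? h) (λ m∸t≤h →
          <⇒≱ 2h<m (≤-trans (m≤n+m∸n m t) (+-mono-≤ (does≡true⇒ (t ≤? h) (∧-conicalʳ _ _ low-t)) m∸t≤h))) =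
        ∧-zeroʳ _

  antipode : ℕ → ℕ → Bool
  antipode p t = does (t ≟ p)

  module _ {p} (m≡p+p : m ≡ p + p) where

    m∸p≡p : m ∸ p ≡ p
    m∸p≡p = trans (cong (_∸ p) m≡p+p) (m+n∸n≡m p p)

    antipode-isConnectionSet : 0 < p → IsConnectionSet (antipode p)
    antipode-isConnectionSet 0<p = record { zero∉ = dec-false (0 ≟ p) (<⇒≢ 0<p) ; symmetric = symmetric }
      where
        symmetric : ∀ {t} → 0 < t → t < m → antipode p (m ∸ t) ≡ antipode p t
        symmetric {t} _ t<m = does-⇔ (mk⇔ to λ { refl → m∸p≡p }) (m ∸ t ≟ p) (t ≟ p)
          where
            to : m ∸ t ≡ p → t ≡ p
            to m∸t≡p = trans (sym (m∸[m∸n]≡n (<⇒≤ t<m))) (trans (cong (m ∸_) m∸t≡p) m∸p≡p)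

    count-band∪antipode : ∀ {h} → h < p → count m (λ t → band h t ∨ antipode p t) ≡ suc (h + h)
    count-band∪antipode {h} h<p =
      trans (count-∨ m (band h) (antipode p) disjoint)
        (trans (cong₂ _+_ (count-band 2h<m) (count-≟ m p<m)) (+-comm (h + h) 1))
      where
        p<m : p < m
        p<m = subst (p <_) (sym m≡p+p) (m<m+n p (≤-<-trans z≤n h<p))
        2h<m : h + h < m
        2h<m = subst (h + h <_) (sym m≡p+p) (+-mono-< h<p h<p)
        disjoint : ∀ t → t < m → band h t ≡ true → antipode p t ≡ false
        disjoint t _ band-t = dec-false (t ≟ p) λ { refl →
          contradiction (trans (sym band-t) (band-∌ h<p (subst (h <_) (sym m∸p≡p) h<p))) λ () }

  connectionSet-of-size : ∀ {k} → 2 ≤ k → k < m → 2 ∣ m * k →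
                  Σ (ℕ → Bool) λ C → IsConnectionSet C × count m C ≡ k × band 1 ⊆ C
  connectionSet-of-size {k} 2≤k k<m 2∣mk with evenOrOdd k
  ... | h , inj₁ refl = band h , band-isConnectionSet , count-band k<m , band-mono (half-positive (m≤n⇒m≤1+n 2≤k))
  ... | h , inj₂ refl with euclidsLemma m k prime[2] 2∣mk
  ...   | inj₂ 2∣k             = contradiction 2∣k (odd-indivisible h)
  ...   | inj₁ (divides p m≡p*2) =
      (λ t → band h t ∨ antipode p t)
    , ∪-isConnectionSet band-isConnectionSet (antipode-isConnectionSet m≡p+p (≤-<-trans z≤n h<p))
    , count-band∪antipode m≡p+p h<p
    , λ t ring-t → cong (_∨ antipode p t) (band-mono (half-positive 2≤k) t ring-t)
    where
      m≡p+p : m ≡ p + p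
      m≡p+p = trans m≡p*2 (trans (*-comm p 2) (cong (p +_) (+-identityʳ p)))
      h<p : h < p
      h<p = ≰⇒> λ p≤h → <⇒≱ (subst (suc (h + h) <_) m≡p+p k<m) (m≤n⇒m≤1+n (+-mono-≤ p≤h p≤h))

-- Two hubs and two leaves around a circulant

module Frame (m : ℕ) where
  open Circulant m

  N : ℕ
  N = 4 + m

  hubRow : Bool → ℕ → Bool
  hubRow joined j = if does (j <? m) then joined else true

  -- Vertices 0, 1 are the hubs, 2 + i (i < m) is vertex i of circulant C, and
  -- 2 + m, 3 + m are the leaves, adjacent to both hubs.  When joined is true the
  -- hubs are also adjacent to each other and to every circulant vertex.
  frame : Bool → (ℕ → Bool) → ℕ → ℕ → Bool
  frame joined C 0             0             = false
  frame joined C 0             1             = joined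
  frame joined C 0             (suc (suc j)) = hubRow joined j
  frame joined C 1             0             = joined
  frame joined C 1             1             = false
  frame joined C 1             (suc (suc j)) = hubRow joined j
  frame joined C (suc (suc i)) 0             = hubRow joined i
  frame joined C (suc (suc i)) 1             = hubRow joined i
  frame joined C (suc (suc i)) (suc (suc j)) = circulant C i j

  frameGraph : Bool → (ℕ → Bool) → Graph N
  frameGraph joined C u v = frame joined C (toℕ u) (toℕ v)

  hubRow-inside : ∀ b {j} → j < m → hubRow b j ≡ b
  hubRow-inside b {j} j<m rewrite dec-true (j <? m) j<m = refl

  hubRow-outside : ∀ b {j} → m ≤ j → hubRow b j ≡ true
  hubRow-outside b {j} m≤j rewrite dec-false (j <? m) (≤⇒≯ m≤j) = refl

  hubRow-true : ∀ j → hubRow true j ≡ true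
  hubRow-true j with j <? m
  ... | yes j<m = hubRow-inside true j<m
  ... | no  j≮m = hubRow-outside true (≮⇒≥ j≮m)

  frame-simple : ∀ {C} → IsConnectionSet C → ∀ b → IsSimple (frameGraph b C)
  frame-simple {C} isC b = (λ u v → frame-sym (toℕ u) (toℕ v)) , (λ v → frame-irreflexive (toℕ v))
    where
      frame-sym : ∀ i j → frame b C i j ≡ frame b C j i
      frame-sym 0             0             = refl
      frame-sym 0             1             = refl
      frame-sym 0             (suc (suc j)) = refl
      frame-sym 1             0             = refl
      frame-sym 1             1             = refl
      frame-sym 1             (suc (suc j)) = refl
      frame-sym (suc (suc i)) 0             = refl
      frame-sym (suc (suc i)) 1             = refl
      frame-sym (suc (suc i)) (suc (suc j)) = circulant-sym C isC i j
      frame-irreflexive : ∀ i → frame b C i i ≡ false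
      frame-irreflexive 0             = refl
      frame-irreflexive 1             = refl
      frame-irreflexive (suc (suc i)) = circulant-irreflexive C isC i

  frame-mono : ∀ {C D} → C ⊆ D → SubgraphOf (frameGraph false C) (frameGraph true D)
  frame-mono {C} {D} C⊆D u v = mono (toℕ u) (toℕ v)
    where
      mono : ∀ i j → frame false C i j ≡ true → frame true D i j ≡ true
      mono 0             0             ()
      mono 0             1             ()
      mono 0             (suc (suc j)) _ = hubRow-true j
      mono 1             0             ()
      mono 1             1             ()
      mono 1             (suc (suc j)) _ = hubRow-true j
      mono (suc (suc i)) 0             _ = hubRow-true i
      mono (suc (suc i)) 1             _ = hubRow-true i
      mono (suc (suc i)) (suc (suc j)) e = circulant-mono C⊆D i j e

  hub-degree : ∀ b → bit b + count (2 + m) (hubRow b) ≡ (if b then 3 + m else 2)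
  hub-degree true  = cong suc (count-true (2 + m) λ j _ → hubRow-true j)
  hub-degree false =
    trans (count-split m 2 (hubRow false) (+-comm m 2))
      (cong₂ _+_ (count-false m λ _ j<m → hubRow-inside false j<m)
                 (count-true 2 λ k _ → hubRow-outside false (m≤m+n m k)))

  deg-frame-hub : ∀ b C {v : Fin N} → toℕ v < 2 → deg (frameGraph b C) v ≡ (if b then 3 + m else 2)
  deg-frame-hub b C {v} v<2 = trans (deg-toℕ (frame b C) v) (hub-row (toℕ v) v<2)
    where
      hub-row : ∀ i → i < 2 → count N (frame b C i) ≡ (if b then 3 + m else 2)
      hub-row 0             _                   = hub-degree b
      hub-row 1             _                   = hub-degree b
      hub-row (suc (suc i)) (s≤s (s≤s ()))

  deg-frame-middle : ∀ b C {v : Fin N} → 2 ≤ toℕ v → toℕ v < 2 + m →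
                     deg (frameGraph b C) v ≡ bit b + (bit b + count m C)
  deg-frame-middle b C {v} 2≤v v<2+m = trans (deg-toℕ (frame b C) v) (middle-row (toℕ v) 2≤v v<2+m)
    where
      middle-row : ∀ i → 2 ≤ i → i < 2 + m → count N (frame b C i) ≡ bit b + (bit b + count m C)
      middle-row 1             (s≤s ()) _
      middle-row (suc (suc i)) _ (s≤s (s≤s i<m)) rewrite hubRow-inside b i<m =
        cong (λ c → bit b + (bit b + c))
          (trans (count-split m 2 (circulant C i) (+-comm m 2))
            (trans (cong₂ _+_ (count-circulant C i<m) (count-false 2 λ k _ → circulant-outsideʳ C i (m≤m+n m k)))
                   (+-identityʳ (count m C))))

  deg-frame-leaf : ∀ b C {v : Fin N} → 2 + m ≤ toℕ v → deg (frameGraph b C) v ≡ 2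
  deg-frame-leaf b C {v} 2+m≤v = trans (deg-toℕ (frame b C) v) (leaf-row (toℕ v) 2+m≤v)
    where
      leaf-row : ∀ i → 2 + m ≤ i → count N (frame b C i) ≡ 2
      leaf-row (suc (suc i)) (s≤s (s≤s m≤i)) rewrite hubRow-outside b m≤i =
        cong (2 +_) (count-false (2 + m) λ j _ → circulant-outsideˡ C j m≤i)

  region : ∀ i → i < 2 ⊎ (2 ≤ i × i < 2 + m) ⊎ 2 + m ≤ i
  region 0             = inj₁ z<s
  region 1             = inj₁ (s<s z<s)
  region (suc (suc i)) with i <? m
  ... | yes i<m = inj₂ (inj₁ (s≤s (s≤s z≤n) , s<s (s<s i<m)))
  ... | no  i≮m = inj₂ (inj₂ (s≤s (s≤s (≮⇒≥ i≮m))))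

  frame-realizes : ∀ {C k} → IsConnectionSet C → count m C ≡ k → Realizes (frameGraph true C) (seqD N (2 + k))
  frame-realizes {C} {k} isC |C|≡k = frame-simple isC true , degree
    where
      degree : ∀ v → deg (frameGraph true C) v ≡ seqD N (2 + k) v
      degree v with region (toℕ v)
      ... | inj₁ v<2 = trans (deg-frame-hub true C v<2) (sym (seqD-hub N (2 + k) v v<2))
      ... | inj₂ (inj₁ (2≤v , v<2+m)) =
        trans (deg-frame-middle true C 2≤v v<2+m) (trans (cong (2 +_) |C|≡k) (sym (seqD-middle N (2 + k) v 2≤v v<2+m)))
      ... | inj₂ (inj₂ 2+m≤v) =
        trans (deg-frame-leaf true C 2+m≤v) (sym (seqD-leaf N (2 + k) v (≤-trans (m≤m+n 2 m) 2+m≤v) 2+m≤v))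

  ring-frame-regular : 2 < m → Regular 2 (frameGraph false (band 1))
  ring-frame-regular 2<m v with region (toℕ v)
  ... | inj₁ v<2                = deg-frame-hub false (band 1) v<2
  ... | inj₂ (inj₁ (2≤v , v<2+m)) = trans (deg-frame-middle false (band 1) 2≤v v<2+m) (count-band 2<m)
  ... | inj₂ (inj₂ 2+m≤v)       = deg-frame-leaf false (band 1) 2+m≤v

  frame-factorable : ∀ {C k} → IsConnectionSet C → count m C ≡ k → band 1 ⊆ C → 2 < m →
                     Graphic (seqD N (2 + k)) × Factorable 2 (seqD N (2 + k))
  frame-factorable {C} isC |C|≡k ring⊆C 2<m =
      (frameGraph true C , frame-realizes isC |C|≡k)
    , (frameGraph true C , frame-realizes isC |C|≡k
      , frameGraph false (band 1) , frame-simple band-isConnectionSet false , frame-mono ring⊆C , ring-frame-regular 2<m)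

mainTheorem1 : (n x : ℕ) → 4 ≤ x → x ≤ n ∸ 3 → 2 ∣ (n ∸ 4) * x →
    (Graphic (seqD n x) × Factorable 2 (seqD n x)) × ¬ HasConnectedFactor 2 (seqD n x)
mainTheorem1 (suc (suc (suc (suc m)))) (suc (suc k)) (s≤s (s≤s 2≤k)) (s≤s k<m) 2∣m*x
  with C , isC , |C|≡k , ring⊆C ← Circulant.connectionSet-of-size m 2≤k k<m
                                      (∣m+n∣m⇒∣n (subst (2 ∣_) (*-distribˡ-+ m 2 k) 2∣m*x) (n∣m*n m))
  = Frame.frame-factorable m isC |C|≡k ring⊆C (≤-<-trans 2≤k k<m)
  , NoConnectedFactor.noConnectedFactor m (2 + k) (≤-<-trans z≤n k<m)
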